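{- For integers $m\ge2$ and $n\ge3$, the complete slashed ladder graph $KL_{m,n}$ has $\operatorname{mfgon}(KL_{m,n})=n+m-2$.
   Context: The $2\times m$ slashed ladder graph has vertices $u_1,\dots,u_m,v_1,\dots,v_m$, edges $u_iu_{i+1}$ and $v_iv_{i+1}$ for $1\le i<m$, rungs $u_iv_i$ for $1\le i\le m$, and, for each $1\le i<m$, one diagonal edge: $u_iv_{i+1}$ if $i$ is odd and $v_iu_{i+1}$ if $i$ is even. The complete slashed ladder $KL_{m,n}$ is the simple graph obtained by attaching a complete graph $K_n$ to the last column so that two vertices of $K_n$ are identified with $u_m$ and $v_m$ (the edge $u_mv_m$ being shared). A divisor is an integer combination $D=\sum_wD(w)(w)$ of vertices, degree $\sum_wD(w)$, effective if all $D(w)\ge0$. Divisors are equivalent if their difference lies in the integer column space of the Laplacian. The rank $r(D)$ is $-1$ if $D$ is not equivalent to an effective divisor, else the largest $r\ge0$ such that $D-E$ is equivalent to an effective divisor for all effective $E$ of degree $r$. $\operatorname{mfgon}$ is the minimum degree of a positive-rank effective divisor $D$ with $D(w)\le1$ for all $w$. -}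

module Defs where

open import Data.Bool using (Bool; true; false; _∧_; _∨_; not; if_then_else_)
open import Data.Nat as ℕ using (ℕ; zero; suc; _∸_; _≡ᵇ_; _<ᵇ_)
open import Data.Fin using (Fin; toℕ)
import Data.Fin as Fin
open import Data.Integer as ℤ using (ℤ; +_; -_; _-_; _*_; _≤_)
open import Data.Product using (Σ; _×_)
open import Relation.Binary.PropositionalEquality using (_≡_)

-- Generic finite simple graphs on vertex set Fin N, given by a Bool
-- adjacency function (intended symmetric and irreflexive).

sumFin : ∀ {N} → (Fin N → ℤ) → ℤ
sumFin {zero}  f = + 0
sumFin {suc N} f = f Fin.zero ℤ.+ sumFin {N} (λ i → f (Fin.suc i))

Adjacency : ℕ → Set
Adjacency N = Fin N → Fin N → Bool

degree : ∀ {N} → Adjacency N → Fin N → ℤ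
degree adj x = sumFin (λ w → if adj x w then + 1 else + 0)

laplacian : ∀ {N} → Adjacency N → Fin N → Fin N → ℤ
laplacian adj x w =
  if toℕ x ≡ᵇ toℕ w then degree adj x
  else (if adj x w then ℤ.-[1+ 0 ] else + 0)

Divisor : ℕ → Set
Divisor N = Fin N → ℤ

divDeg : ∀ {N} → Divisor N → ℤ
divDeg D = sumFin D

Effective : ∀ {N} → Divisor N → Set
Effective D = ∀ v → + 0 ≤ D v

Equiv : ∀ {N} → Adjacency N → Divisor N → Divisor N → Set
Equiv {N} adj D D' =
  Σ (Fin N → ℤ) λ z → ∀ x → D x - D' x ≡ sumFin (λ w → laplacian adj x w * z w)

EquivEffective : ∀ {N} → Adjacency N → Divisor N → Set
EquivEffective {N} adj D = Σ (Divisor N) λ D' → Effective D' × Equiv adj D D'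

-- the defining property for "r(D) ≥ r" (r ≥ 0): for all effective E of
-- degree r, D - E is equivalent to an effective divisor
RankProp : ∀ {N} → Adjacency N → Divisor N → ℕ → Set
RankProp {N} adj D r =
  (E : Divisor N) → Effective E → divDeg E ≡ + r →
  EquivEffective adj (λ v → D v - E v)

PositiveRank : ∀ {N} → Adjacency N → Divisor N → Set
PositiveRank adj D = Σ ℕ λ r → (1 ℕ.≤ r) × RankProp adj D r

MultFree : ∀ {N} → Divisor N → Set
MultFree D = ∀ v → D v ≤ + 1

-- mfgon(G) = k : k is the minimum degree of an effective, multiplicity-free
-- divisor of positive rank
MfgonIs : ∀ {N} → Adjacency N → ℕ → Set
MfgonIs {N} adj k =
  (Σ (Divisor N) λ D → Effective D × MultFree D × PositiveRank adj D × divDeg D ≡ + k)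
  × ((D : Divisor N) → Effective D → MultFree D → PositiveRank adj D → + k ≤ divDeg D)

-- Vertex set Fin (2m + (n-2)); label a (0-based):
--   a < m        : u_{a+1}
--   m ≤ a < 2m   : v_{a-m+1}
--   a ≥ 2m       : the n-2 remaining vertices of K_n

data Cls : Set where
  U  : ℕ → Cls   -- u_{i+1}, i 0-based
  V  : ℕ → Cls   -- v_{i+1}, i 0-based
  K  : Cls

classify : ℕ → ℕ → Cls
classify m a =
  if a <ᵇ m then U a
  else (if a <ᵇ (m ℕ.+ m) then V (a ∸ m) else K)

evenᵇ : ℕ → Bool
evenᵇ zero    = true
evenᵇ (suc k) = not (evenᵇ k)

-- directed description of the ladder edges (0-based column indices i;
-- paper index i+1 odd  ⇔  i even)
ladderEdge : Cls → Cls → Bool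
ladderEdge (U i) (U j) = j ≡ᵇ suc i
ladderEdge (V i) (V j) = j ≡ᵇ suc i
ladderEdge (U i) (V j) = (j ≡ᵇ i) ∨ ((j ≡ᵇ suc i) ∧ evenᵇ i)   -- rung, diagonal u_i v_{i+1} (i odd, 1-based)
ladderEdge (V i) (U j) = (j ≡ᵇ suc i) ∧ not (evenᵇ i)          -- diagonal v_i u_{i+1} (i even, 1-based)
ladderEdge _ _ = false

-- membership in the attached K_n: u_m, v_m and the extra vertices
inClique : ℕ → Cls → Bool
inClique m (U i) = i ≡ᵇ (m ∸ 1)
inClique m (V i) = i ≡ᵇ (m ∸ 1)
inClique m K     = true

KLvert : ℕ → ℕ → ℕ
KLvert m n = (m ℕ.+ m) ℕ.+ (n ∸ 2)

KLadj : (m n : ℕ) → Adjacency (KLvert m n)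
KLadj m n x y =
  not (toℕ x ≡ᵇ toℕ y) ∧
  (ladderEdge cx cy ∨ ladderEdge cy cx ∨ (inClique m cx ∧ inClique m cy))
  where
  cx = classify m (toℕ x)
  cy = classify m (toℕ y)

-- In each of the first m − 1 columns take the vertex that does not start the slash into
-- the next column, and add one vertex of K_n outside the ladder: this is an independent set I, and
-- the complement of an independent set in a graph without isolated vertices has positive rank (if the
-- chip to be removed sits at q ∈ I, let q borrow from its neighbours, all of which carry a chip).
-- The complement of I has degree (m − 1) + (n − 1).
--
-- Let D be multiplicity-free of positive rank and D(q) = 0. If z is a firing script
-- taking D − q to an effective divisor, then (Dhar) the set A of maximisers of z is nonempty, avoids
-- q, and every x ∈ A has at most D(x) ≤ 1 neighbours outside A. In each column one vertex is adjacent
-- to its partner and to both vertices of each neighbouring column, so A meets every column as soon as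
-- it meets one, and it meets the last column. Hence D vanishes neither on a whole column nor on two
-- vertices of K_n, and counting column by column gives deg D ≥ (m − 1) + (n − 1).

module Submission where

open import Defs
open import Data.Nat as ℕ using (ℕ; zero; suc; _+_; _≤_; _<_; _∸_; _≡ᵇ_; z≤n; s≤s)
import Data.Nat.Properties as ℕ
open import Data.Bool using (Bool; true; false; T; _∧_; _∨_; not; if_then_else_)
open import Data.Fin using (Fin; toℕ)
import Data.Fin as Fin
import Data.Bool.Properties as Bool
import Data.Fin.Properties as Fin
open import Data.Integer using (ℤ; +_; -_; -[1+_]; _-_; _*_; +≤+; -<+; nonNegative) renaming (_+_ to _+ℤ_; _≤_ to _≤ℤ_; _<_ to _<ℤ_)
import Data.Integer.Properties as ℤ
open import Data.Integer.Tactic.RingSolver using (solve-∀)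
import Data.Nat.Tactic.RingSolver as ℕ-Solver
open import Data.Product using (Σ; _×_; _,_; proj₁; proj₂)
open import Data.Sum as Sum using (_⊎_; inj₁; inj₂)
open import Data.Empty using (⊥; ⊥-elim)
open import Function using (id; _∘_)
open import Relation.Nullary using (¬_; yes; no; does)
open import Relation.Nullary.Decidable using (decidable-stable)
open import Relation.Binary.PropositionalEquality

≡ᵇ⇒≡ : ∀ a b → (a ≡ᵇ b) ≡ true → a ≡ b
≡ᵇ⇒≡ a b a≡ᵇb = ℕ.≡ᵇ⇒≡ a b (subst T (sym a≡ᵇb) _)

≡ᵇ-refl : ∀ a → (a ≡ᵇ a) ≡ true
≡ᵇ-refl zero    = refl
≡ᵇ-refl (suc a) = ≡ᵇ-refl a

≡ᵇ-sym : ∀ a b → (a ≡ᵇ b) ≡ (b ≡ᵇ a)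
≡ᵇ-sym zero    zero    = refl
≡ᵇ-sym zero    (suc b) = refl
≡ᵇ-sym (suc a) zero    = refl
≡ᵇ-sym (suc a) (suc b) = ≡ᵇ-sym a b

≢⇒≡ᵇ-false : ∀ a b → a ≢ b → (a ≡ᵇ b) ≡ false
≢⇒≡ᵇ-false zero    zero    a≢b = ⊥-elim (a≢b refl)
≢⇒≡ᵇ-false zero    (suc b) _   = refl
≢⇒≡ᵇ-false (suc a) zero    _   = refl
≢⇒≡ᵇ-false (suc a) (suc b) a≢b = ≢⇒≡ᵇ-false a b (a≢b ∘ cong suc)

<ᵇ-true : ∀ a b → a < b → (a ℕ.<ᵇ b) ≡ true
<ᵇ-true zero    (suc b) _         = refl
<ᵇ-true (suc a) (suc b) (s≤s a<b) = <ᵇ-true a b a<b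

<ᵇ-false : ∀ a b → b ≤ a → (a ℕ.<ᵇ b) ≡ false
<ᵇ-false a       zero    _         = refl
<ᵇ-false (suc a) (suc b) (s≤s b≤a) = <ᵇ-false a b b≤a

<ᵇ⇒< : ∀ a b → (a ℕ.<ᵇ b) ≡ true → a < b
<ᵇ⇒< a b a<ᵇb = ℕ.<ᵇ⇒< a b (subst T (sym a<ᵇb) _)

∨≡true : ∀ a b → (a ∨ b) ≡ true → a ≡ true ⊎ b ≡ true
∨≡true true  b _   = inj₁ refl
∨≡true false b b≡t = inj₂ b≡t

false≢true : false ≢ true
false≢true ()

1≢0 : + 1 ≢ + 0
1≢0 ()

not-both-true : ∀ b → b ≡ true → not b ≡ true → ⊥
not-both-true true _ ()

+-cancelʳ-≤ : ∀ k {i j} → i +ℤ k ≤ℤ j +ℤ k → i ≤ℤ j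
+-cancelʳ-≤ k {i} {j} i+k≤j+k = subst₂ _≤ℤ_ (cancel i) (cancel j) (ℤ.+-monoˡ-≤ (- k) i+k≤j+k)
  where
  cancel : ∀ a → (a +ℤ k) - k ≡ a
  cancel a = trans (ℤ.+-assoc a k (- k)) (trans (cong (_+ℤ_ a) (ℤ.+-inverseʳ k)) (ℤ.+-identityʳ a))

i<j⇒1≤j-i : ∀ {i j} → i <ℤ j → + 1 ≤ℤ j - i
i<j⇒1≤j-i {i} {j} i<j = subst (_≤ℤ j - i) (cancel i) (ℤ.+-monoˡ-≤ (- i) (ℤ.i<j⇒suc[i]≤j i<j))
  where
  cancel : ∀ a → (+ 1 +ℤ a) - a ≡ + 1
  cancel = solve-∀

nonneg-≢0⇒≥1 : ∀ {i} → + 0 ≤ℤ i → i ≢ + 0 → + 1 ≤ℤ i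
nonneg-≢0⇒≥1 {+ zero}  _ i≢0 = ⊥-elim (i≢0 refl)
nonneg-≢0⇒≥1 {+ suc _} _ _   = +≤+ (s≤s z≤n)

nonneg-+≡0 : ∀ {i j} → + 0 ≤ℤ i → + 0 ≤ℤ j → i +ℤ j ≡ + 0 → i ≡ + 0 × j ≡ + 0
nonneg-+≡0 {+ zero} {+ zero} _ _ _ = refl , refl

+1-step : ∀ {k s t} → + k ≤ℤ s → + 1 ≤ℤ t → + suc k ≤ℤ s +ℤ t
+1-step {k} {s} {t} k≤s 1≤t = subst (_≤ℤ s +ℤ t) (cong +_ (ℕ.+-comm k 1)) (ℤ.+-mono-≤ k≤s 1≤t)

sumFin-cong : ∀ {N} (f g : Fin N → ℤ) → (∀ i → f i ≡ g i) → sumFin f ≡ sumFin g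
sumFin-cong {zero}  f g e = refl
sumFin-cong {suc N} f g e = cong₂ _+ℤ_ (e Fin.zero) (sumFin-cong _ _ (λ i → e (Fin.suc i)))

sumFin-mono : ∀ {N} (f g : Fin N → ℤ) → (∀ i → f i ≤ℤ g i) → sumFin f ≤ℤ sumFin g
sumFin-mono {zero}  f g e = ℤ.≤-refl
sumFin-mono {suc N} f g e = ℤ.+-mono-≤ (e Fin.zero) (sumFin-mono _ _ (λ i → e (Fin.suc i)))

sumFin-+ : ∀ {N} (f g : Fin N → ℤ) → sumFin (λ i → f i +ℤ g i) ≡ sumFin f +ℤ sumFin g
sumFin-+ {zero}  f g = refl
sumFin-+ {suc N} f g
  rewrite sumFin-+ (λ i → f (Fin.suc i)) (λ i → g (Fin.suc i)) = interchange (f Fin.zero) (g Fin.zero) _ _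
  where
  interchange : ∀ a b c d → (a +ℤ b) +ℤ (c +ℤ d) ≡ (a +ℤ c) +ℤ (b +ℤ d)
  interchange = solve-∀

sumFin-neg : ∀ {N} (f : Fin N → ℤ) → sumFin (λ i → - f i) ≡ - sumFin f
sumFin-neg {zero}  f = refl
sumFin-neg {suc N} f
  rewrite sumFin-neg (λ i → f (Fin.suc i)) = sym (ℤ.neg-distrib-+ (f Fin.zero) _)

sumFin-*ˡ : ∀ {N} c (f : Fin N → ℤ) → sumFin (λ i → c * f i) ≡ c * sumFin f
sumFin-*ˡ {zero}  c f = sym (ℤ.*-zeroʳ c)
sumFin-*ˡ {suc N} c f
  rewrite sumFin-*ˡ c (λ i → f (Fin.suc i)) = sym (ℤ.*-distribˡ-+ c (f Fin.zero) _)

sumFin-zero : ∀ {N} → sumFin {N} (λ _ → + 0) ≡ + 0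
sumFin-zero {zero}  = refl
sumFin-zero {suc N} rewrite sumFin-zero {N} = refl

sumFin-δ : ∀ {N} (x : Fin N) (g : Fin N → ℤ) →
           sumFin (λ w → if toℕ x ≡ᵇ toℕ w then g w else + 0) ≡ g x
sumFin-δ {suc N} Fin.zero    g = trans (cong (_+ℤ_ (g Fin.zero)) (sumFin-zero {N})) (ℤ.+-identityʳ _)
sumFin-δ {suc N} (Fin.suc x) g = trans (ℤ.+-identityˡ _) (sumFin-δ x (λ w → g (Fin.suc w)))

sumFin-nonneg : ∀ {N} (f : Fin N → ℤ) → (∀ i → + 0 ≤ℤ f i) → + 0 ≤ℤ sumFin f
sumFin-nonneg {N} f f≥0 = subst (_≤ℤ sumFin f) (sumFin-zero {N}) (sumFin-mono (λ _ → + 0) f f≥0)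

sumFin-≥-point : ∀ {N} (f : Fin N → ℤ) → (∀ i → + 0 ≤ℤ f i) → ∀ i → f i ≤ℤ sumFin f
sumFin-≥-point {suc N} f f≥0 Fin.zero =
  subst (_≤ℤ sumFin f) (ℤ.+-identityʳ _) (ℤ.+-monoʳ-≤ (f Fin.zero) (sumFin-nonneg _ (λ i → f≥0 (Fin.suc i))))
sumFin-≥-point {suc N} f f≥0 (Fin.suc i) =
  subst (_≤ℤ sumFin f) (ℤ.+-identityˡ _) (ℤ.+-mono-≤ (f≥0 Fin.zero) (sumFin-≥-point _ (λ j → f≥0 (Fin.suc j)) i))

sumFin-≥-pair : ∀ {N} (f : Fin N → ℤ) → (∀ i → + 0 ≤ℤ f i) → ∀ i j → i ≢ j → f i +ℤ f j ≤ℤ sumFin f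
sumFin-≥-pair {suc N} f f≥0 Fin.zero Fin.zero i≢j = ⊥-elim (i≢j refl)
sumFin-≥-pair {suc N} f f≥0 Fin.zero (Fin.suc j) _ =
  ℤ.+-monoʳ-≤ (f Fin.zero) (sumFin-≥-point _ (λ k → f≥0 (Fin.suc k)) j)
sumFin-≥-pair {suc N} f f≥0 (Fin.suc i) Fin.zero _ =
  subst (_≤ℤ sumFin f) (ℤ.+-comm (f Fin.zero) _)
    (ℤ.+-monoʳ-≤ (f Fin.zero) (sumFin-≥-point _ (λ k → f≥0 (Fin.suc k)) i))
sumFin-≥-pair {suc N} f f≥0 (Fin.suc i) (Fin.suc j) i≢j =
  subst (_≤ℤ sumFin f) (ℤ.+-identityˡ _)
    (ℤ.+-mono-≤ (f≥0 Fin.zero) (sumFin-≥-pair _ (λ k → f≥0 (Fin.suc k)) i j (i≢j ∘ cong Fin.suc)))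

sumFin-≢0 : ∀ {N} (f : Fin N → ℤ) → sumFin f ≢ + 0 → Σ (Fin N) λ i → f i ≢ + 0
sumFin-≢0 {zero}  f s≢0 = ⊥-elim (s≢0 refl)
sumFin-≢0 {suc N} f s≢0 with f Fin.zero ℤ.≟ + 0
... | no  f₀≢0 = Fin.zero , f₀≢0
... | yes f₀≡0 with sumFin-≢0 (λ i → f (Fin.suc i)) (λ s≡0 → s≢0 (cong₂ _+ℤ_ f₀≡0 s≡0))
...   | i , fi≢0 = Fin.suc i , fi≢0

effective-degree1⇒unit : ∀ {N} (E : Divisor N) → Effective E → divDeg E ≡ + 1 →
                         Σ (Fin N) λ q → E q ≡ + 1 × (∀ x → x ≢ q → E x ≡ + 0)
effective-degree1⇒unit E E≥0 deg≡1 = q , Eq≡1 , Ex≡0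
  where
  support = sumFin-≢0 E (λ deg≡0 → 1≢0 (trans (sym deg≡1) deg≡0))
  q = proj₁ support
  E≤1 : ∀ x → E x ≤ℤ + 1
  E≤1 x = subst (E x ≤ℤ_) deg≡1 (sumFin-≥-point E E≥0 x)
  Eq≡1 : E q ≡ + 1
  Eq≡1 = ℤ.≤-antisym (E≤1 q) (ℤ.i<j⇒suc[i]≤j (ℤ.≤∧≢⇒< (E≥0 q) (proj₂ support ∘ sym)))
  Ex≡0 : ∀ x → x ≢ q → E x ≡ + 0
  Ex≡0 x x≢q = ℤ.≤-antisym (+-cancelʳ-≤ (+ 1) Ex+1≤1) (E≥0 x)
    where
    Ex+1≤1 : E x +ℤ + 1 ≤ℤ + 0 +ℤ + 1
    Ex+1≤1 = subst₂ (λ a b → E x +ℤ a ≤ℤ b) Eq≡1 deg≡1 (sumFin-≥-pair E E≥0 x q x≢q)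

sumUpTo : ℕ → (ℕ → ℤ) → ℤ
sumUpTo zero    h = + 0
sumUpTo (suc k) h = sumUpTo k h +ℤ h k

sumUpTo-cons : ∀ k h → sumUpTo (suc k) h ≡ h 0 +ℤ sumUpTo k (λ a → h (suc a))
sumUpTo-cons zero    h = ℤ.+-comm (+ 0) (h 0)
sumUpTo-cons (suc k) h = begin
  sumUpTo (suc k) h +ℤ h (suc k)                     ≡⟨ cong (_+ℤ h (suc k)) (sumUpTo-cons k h) ⟩
  (h 0 +ℤ sumUpTo k (λ a → h (suc a))) +ℤ h (suc k)  ≡⟨ ℤ.+-assoc (h 0) _ _ ⟩
  h 0 +ℤ sumUpTo (suc k) (λ a → h (suc a))           ∎
  where open ≡-Reasoning

sumFin≡sumUpTo : ∀ {N} (f : Fin N → ℤ) (h : ℕ → ℤ) → (∀ i → f i ≡ h (toℕ i)) → sumFin f ≡ sumUpTo N h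
sumFin≡sumUpTo {zero}  f h f≡h = refl
sumFin≡sumUpTo {suc N} f h f≡h = begin
  f Fin.zero +ℤ sumFin (λ i → f (Fin.suc i))
    ≡⟨ cong₂ _+ℤ_ (f≡h Fin.zero) (sumFin≡sumUpTo _ (λ a → h (suc a)) (λ i → f≡h (Fin.suc i))) ⟩
  h 0 +ℤ sumUpTo N (λ a → h (suc a))
    ≡⟨ sumUpTo-cons N h ⟨
  sumUpTo (suc N) h ∎
  where open ≡-Reasoning

sumUpTo-+ : ∀ k l h → sumUpTo (k + l) h ≡ sumUpTo k h +ℤ sumUpTo l (λ a → h (k + a))
sumUpTo-+ k zero    h rewrite ℕ.+-identityʳ k = sym (ℤ.+-identityʳ _)
sumUpTo-+ k (suc l) h rewrite ℕ.+-suc k l =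
  trans (cong (_+ℤ h (k + l)) (sumUpTo-+ k l h)) (ℤ.+-assoc (sumUpTo k h) _ _)

sumUpTo-distrib : ∀ k f g → sumUpTo k (λ a → f a +ℤ g a) ≡ sumUpTo k f +ℤ sumUpTo k g
sumUpTo-distrib zero    f g = refl
sumUpTo-distrib (suc k) f g rewrite sumUpTo-distrib k f g = interchange (sumUpTo k f) (sumUpTo k g) (f k) (g k)
  where
  interchange : ∀ a b c d → (a +ℤ b) +ℤ (c +ℤ d) ≡ (a +ℤ c) +ℤ (b +ℤ d)
  interchange = solve-∀

sumUpTo-ones : ∀ k f → (∀ a → a < k → f a ≡ + 1) → sumUpTo k f ≡ + k
sumUpTo-ones zero    f f≡1 = refl
sumUpTo-ones (suc k) f f≡1 =
  trans (cong₂ _+ℤ_ (sumUpTo-ones k f (λ a a<k → f≡1 a (ℕ.m<n⇒m<1+n a<k))) (f≡1 k (ℕ.n<1+n k)))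
        (cong +_ (ℕ.+-comm k 1))

sumUpTo-zero-or-≥ : ∀ k f → (∀ a → + 0 ≤ℤ f a) → (Σ ℕ λ a → a < k × f a ≡ + 0) ⊎ + k ≤ℤ sumUpTo k f
sumUpTo-zero-or-≥ zero    f f≥0 = inj₂ (+≤+ z≤n)
sumUpTo-zero-or-≥ (suc k) f f≥0 with sumUpTo-zero-or-≥ k f f≥0 | f k ℤ.≟ + 0
... | inj₁ (a , a<k , fa≡0) | _        = inj₁ (a , ℕ.m<n⇒m<1+n a<k , fa≡0)
... | inj₂ _                | yes fk≡0 = inj₁ (k , ℕ.n<1+n k , fk≡0)
... | inj₂ k≤s              | no fk≢0  = inj₂ (+1-step k≤s (nonneg-≢0⇒≥1 (f≥0 k) fk≢0))

data ZeroCount (k : ℕ) (f : ℕ → ℤ) : Set where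
  two-zeros : ∀ a b → a < b → b < k → f a ≡ + 0 → f b ≡ + 0 → ZeroCount k f
  one-zero  : ∀ a → a < k → f a ≡ + 0 → + k ≤ℤ sumUpTo k f +ℤ + 1 → ZeroCount k f
  no-zero   : + k ≤ℤ sumUpTo k f → ZeroCount k f

zeroCount : ∀ k f → (∀ a → + 0 ≤ℤ f a) → ZeroCount k f
zeroCount zero    f f≥0 = no-zero (+≤+ z≤n)
zeroCount (suc k) f f≥0 with zeroCount k f f≥0 | f k ℤ.≟ + 0
... | two-zeros a b a<b b<k fa≡0 fb≡0 | _ = two-zeros a b a<b (ℕ.m<n⇒m<1+n b<k) fa≡0 fb≡0
... | one-zero a a<k fa≡0 _ | yes fk≡0 = two-zeros a k a<k (ℕ.n<1+n k) fa≡0 fk≡0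
... | one-zero a a<k fa≡0 k≤s+1 | no fk≢0 =
  one-zero a (ℕ.m<n⇒m<1+n a<k) fa≡0
    (subst (_ ≤ℤ_) (swap-last (sumUpTo k f) (f k)) (+1-step k≤s+1 (nonneg-≢0⇒≥1 (f≥0 k) fk≢0)))
  where
  swap-last : ∀ s t → (s +ℤ + 1) +ℤ t ≡ (s +ℤ t) +ℤ + 1
  swap-last = solve-∀
... | no-zero k≤s | yes fk≡0 =
  one-zero k (ℕ.n<1+n k) fk≡0 (subst (_ ≤ℤ_) s+1≡s+fk+1 (+1-step k≤s ℤ.≤-refl))
  where
  s+1≡s+fk+1 : sumUpTo k f +ℤ + 1 ≡ (sumUpTo k f +ℤ f k) +ℤ + 1
  s+1≡s+fk+1 = cong (λ t → t +ℤ + 1)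
    (trans (sym (ℤ.+-identityʳ (sumUpTo k f))) (cong (λ t → sumUpTo k f +ℤ t) (sym fk≡0)))
... | no-zero k≤s | no fk≢0 = no-zero (+1-step k≤s (nonneg-≢0⇒≥1 (f≥0 k) fk≢0))

extend : ∀ {N} {X : Set} → X → (Fin N → X) → ℕ → X
extend {N} d f a with a ℕ.<? N
... | yes a<N = f (Fin.fromℕ< a<N)
... | no  _   = d

module _ {N} {X : Set} (d : X) (f : Fin N → X) where

  extend-fromℕ< : ∀ {a} (a<N : a < N) → extend d f a ≡ f (Fin.fromℕ< a<N)
  extend-fromℕ< {a} a<N with a ℕ.<? N
  ... | yes _   = refl
  ... | no  a≮N = ⊥-elim (a≮N a<N)

  extend-toℕ : ∀ x → extend d f (toℕ x) ≡ f x
  extend-toℕ x = trans (extend-fromℕ< (Fin.toℕ<n x)) (cong f (Fin.fromℕ<-toℕ x (Fin.toℕ<n x)))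

  extend-outside : ∀ {a} → ¬ a < N → extend d f a ≡ d
  extend-outside {a} a≮N with a ℕ.<? N
  ... | yes a<N = ⊥-elim (a≮N a<N)
  ... | no  _   = refl

-- Chip-firing on a finite graph

indicator : Bool → ℤ
indicator b = if b then + 1 else + 0

indicator-nonneg : ∀ b → + 0 ≤ℤ indicator b
indicator-nonneg true  = +≤+ z≤n
indicator-nonneg false = +≤+ z≤n

indicator-≤1 : ∀ b → indicator b ≤ℤ + 1
indicator-≤1 true  = ℤ.≤-refl
indicator-≤1 false = +≤+ z≤n

degree-≥1 : ∀ {N} (adj : Adjacency N) x y → adj x y ≡ true → + 1 ≤ℤ degree adj x
degree-≥1 adj x y x~y = subst (_≤ℤ degree adj x) (cong indicator x~y)
                              (sumFin-≥-point (λ w → indicator (adj x w)) (λ w → indicator-nonneg (adj x w)) y)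

Irreflexive : ∀ {N} → Adjacency N → Set
Irreflexive adj = ∀ x → adj x x ≡ false

outdeg : ∀ {N} → Adjacency N → (Fin N → Bool) → Fin N → ℤ
outdeg adj A x = sumFin (λ w → indicator (adj x w ∧ not (A w)))

module _ {N} (adj : Adjacency N) (A : Fin N → Bool) (x : Fin N) where

  private
    contributions-nonneg : ∀ w → + 0 ≤ℤ indicator (adj x w ∧ not (A w))
    contributions-nonneg w = indicator-nonneg _

    contribution-outside : ∀ y → adj x y ≡ true → A y ≡ false → indicator (adj x y ∧ not (A y)) ≡ + 1
    contribution-outside y x~y y∉A rewrite x~y | y∉A = refl

  outdeg-nonneg : + 0 ≤ℤ outdeg adj A x
  outdeg-nonneg = sumFin-nonneg _ contributions-nonneg

  outdeg-≥1 : ∀ y → adj x y ≡ true → A y ≡ false → + 1 ≤ℤ outdeg adj A x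
  outdeg-≥1 y x~y y∉A =
    subst (_≤ℤ outdeg adj A x) (contribution-outside y x~y y∉A) (sumFin-≥-point _ contributions-nonneg y)

  outdeg-≥2 : ∀ y₁ y₂ → y₁ ≢ y₂ → adj x y₁ ≡ true → A y₁ ≡ false → adj x y₂ ≡ true → A y₂ ≡ false →
              + 2 ≤ℤ outdeg adj A x
  outdeg-≥2 y₁ y₂ y₁≢y₂ x~y₁ y₁∉A x~y₂ y₂∉A =
    subst (_≤ℤ outdeg adj A x) (cong₂ _+ℤ_ (contribution-outside y₁ x~y₁ y₁∉A) (contribution-outside y₂ x~y₂ y₂∉A))
      (sumFin-≥-pair _ contributions-nonneg y₁ y₂ y₁≢y₂)

module _ {N} (adj : Adjacency N) (irr : Irreflexive adj) (z : Fin N → ℤ) (x : Fin N) where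

  private
    δₓ : Fin N → ℤ
    δₓ w = if toℕ x ≡ᵇ toℕ w then degree adj x * z x else + 0

    laplacian-entry : ∀ w → laplacian adj x w * z w ≡ δₓ w +ℤ - (indicator (adj x w) * z w)
    laplacian-entry w with toℕ x ≡ᵇ toℕ w in x≡w
    ... | true with Fin.toℕ-injective {i = x} {j = w} (≡ᵇ⇒≡ _ _ x≡w)
    ...   | refl rewrite irr x = sym (ℤ.+-identityʳ _)
    laplacian-entry w | false with adj x w
    ... | true  = trans (ℤ.-1*i≡-i (z w)) (trans (cong -_ (sym (ℤ.*-identityˡ (z w)))) (sym (ℤ.+-identityˡ _)))
    ... | false = sym (ℤ.+-identityˡ _)

  laplacian-action : sumFin (λ w → laplacian adj x w * z w) ≡ sumFin (λ w → indicator (adj x w) * (z x - z w))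
  laplacian-action = begin
    sumFin (λ w → laplacian adj x w * z w)
      ≡⟨ sumFin-cong _ _ laplacian-entry ⟩
    sumFin (λ w → δₓ w +ℤ - (a w * z w))
      ≡⟨ sumFin-+ δₓ (λ w → - (a w * z w)) ⟩
    sumFin δₓ +ℤ sumFin (λ w → - (a w * z w))
      ≡⟨ cong₂ _+ℤ_ (sumFin-δ x (λ _ → degree adj x * z x)) (sumFin-neg (λ w → a w * z w)) ⟩
    degree adj x * z x +ℤ - sumFin (λ w → a w * z w)
      ≡⟨ cong (_+ℤ - sumFin (λ w → a w * z w)) (trans (ℤ.*-comm (degree adj x) (z x)) (sym (sumFin-*ˡ (z x) a))) ⟩
    sumFin (λ w → z x * a w) +ℤ - sumFin (λ w → a w * z w)
      ≡⟨ cong (_+ℤ_ (sumFin (λ w → z x * a w))) (sym (sumFin-neg (λ w → a w * z w))) ⟩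
    sumFin (λ w → z x * a w) +ℤ sumFin (λ w → - (a w * z w))
      ≡⟨ sumFin-+ (λ w → z x * a w) (λ w → - (a w * z w)) ⟨
    sumFin (λ w → z x * a w +ℤ - (a w * z w))
      ≡⟨ sumFin-cong _ _ (λ w → factor (z x) (a w) (z w)) ⟩
    sumFin (λ w → a w * (z x - z w)) ∎
    where
    open ≡-Reasoning
    a : Fin N → ℤ
    a w = indicator (adj x w)
    factor : ∀ p q r → p * q +ℤ - (q * r) ≡ q * (p - r)
    factor = solve-∀

argmax : ∀ {N} (z : Fin (suc N) → ℤ) → Σ (Fin (suc N)) λ x → ∀ w → z w ≤ℤ z x
argmax {zero}  z = Fin.zero , λ { Fin.zero → ℤ.≤-refl }
argmax {suc N} z with argmax (λ i → z (Fin.suc i))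
... | x , max with ℤ.≤-total (z Fin.zero) (z (Fin.suc x))
...   | inj₁ z₀≤ = Fin.suc x , λ { Fin.zero → z₀≤ ; (Fin.suc w) → max w }
...   | inj₂ ≤z₀ = Fin.zero , λ { Fin.zero → ℤ.≤-refl ; (Fin.suc w) → ℤ.≤-trans (max w) ≤z₀ }

record FiringSet {N} (adj : Adjacency N) (D : Divisor N) : Set where
  field
    member   : Fin N → Bool
    nonempty : Σ (Fin N) λ x → member x ≡ true
    legal    : ∀ x → member x ≡ true → outdeg adj member x ≤ℤ D x

-- Dhar: if F − Lz = F' ≥ 0, a vertex x where z is maximal has F x ≥ (Lz) x = Σ_w [x~w] (z x − z w),
-- and each neighbour w outside the set of maximisers contributes at least 1 to that sum.
maximisers-fire : ∀ {N} (adj : Adjacency N) → Irreflexive adj → Fin N → (F F' : Divisor N) →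
                  Effective F' → Equiv adj F F' → FiringSet adj F
maximisers-fire {suc N} adj irr _ F F' F'≥0 (z , F-F'≡Lz) = record
  { member = A ; nonempty = x₀ , A-max x₀ refl ; legal = legal }
  where
  x₀ = proj₁ (argmax z)
  z≤max : ∀ w → z w ≤ℤ z x₀
  z≤max = proj₂ (argmax z)
  A : Fin (suc N) → Bool
  A w = does (z w ℤ.≟ z x₀)
  A-max : ∀ w → z w ≡ z x₀ → A w ≡ true
  A-max w zw≡max with z w ℤ.≟ z x₀
  ... | yes _     = refl
  ... | no  zw≢max = ⊥-elim (zw≢max zw≡max)
  max-A : ∀ w → A w ≡ true → z w ≡ z x₀
  max-A w Aw with z w ℤ.≟ z x₀
  ... | yes zw≡max = zw≡max
  ... | no  _      = ⊥-elim (false≢true Aw)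
  contribution : ∀ x → z x ≡ z x₀ → ∀ w →
                 indicator (adj x w ∧ not (A w)) ≤ℤ indicator (adj x w) * (z x - z w)
  contribution x zx≡max w with adj x w
  ... | false = ℤ.≤-refl
  ... | true with z w ℤ.≟ z x₀
  ...   | yes _ = subst (+ 0 ≤ℤ_) (sym (ℤ.*-identityˡ _))
                    (ℤ.i≤j⇒0≤j-i (subst (z w ≤ℤ_) (sym zx≡max) (z≤max w)))
  ...   | no zw≢max = subst (+ 1 ≤ℤ_) (sym (ℤ.*-identityˡ _))
                        (i<j⇒1≤j-i (ℤ.≤∧≢⇒< (subst (z w ≤ℤ_) (sym zx≡max) (z≤max w))
                                            (λ zw≡zx → zw≢max (trans zw≡zx zx≡max))))
  legal : ∀ x → A x ≡ true → outdeg adj A x ≤ℤ F x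
  legal x Ax = begin
    outdeg adj A x                                           ≤⟨ sumFin-mono _ _ (contribution x (max-A x Ax)) ⟩
    sumFin (λ w → indicator (adj x w) * (z x - z w))         ≡⟨ laplacian-action adj irr z x ⟨
    sumFin (λ w → laplacian adj x w * z w)                   ≡⟨ F-F'≡Lz x ⟨
    F x - F' x                                               ≤⟨ ℤ.i≤j⇒i-k≤j (F' x) {{nonNegative (F'≥0 x)}} ℤ.≤-refl ⟩
    F x                                                      ∎
    where open ℤ.≤-Reasoning

single : ∀ {N} → Fin N → ℤ → Divisor N
single q c w = if toℕ q ≡ᵇ toℕ w then c else + 0

single-self : ∀ {N} (q : Fin N) c → single q c q ≡ c
single-self q c rewrite ≡ᵇ-refl (toℕ q) = refl

single-nonneg : ∀ {N} (q : Fin N) n → Effective (single q (+ n))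
single-nonneg q n w with toℕ q ≡ᵇ toℕ w
... | true  = +≤+ z≤n
... | false = +≤+ z≤n

divDeg-single : ∀ {N} (q : Fin N) c → divDeg (single q c) ≡ c
divDeg-single q c = sumFin-δ q (λ _ → c)

positiveRank⇒firingSet-avoiding : ∀ {N} (adj : Adjacency N) → Irreflexive adj → (D : Divisor N) (q : Fin N) →
  D q ≡ + 0 → PositiveRank adj D → Σ (FiringSet adj D) λ S → FiringSet.member S q ≡ false
positiveRank⇒firingSet-avoiding adj irr D q Dq≡0 (zero , () , _)
positiveRank⇒firingSet-avoiding adj irr D q Dq≡0 (suc k , _ , rank) =
  record { member = member ; nonempty = nonempty ; legal = legal-D } , q∉S
  where
  E = single q (+ suc k)
  D-E~D' = rank E (single-nonneg q (suc k)) (divDeg-single q (+ suc k))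
  D' = proj₁ D-E~D'
  open FiringSet (maximisers-fire adj irr q (λ v → D v - E v) D' (proj₁ (proj₂ D-E~D')) (proj₂ (proj₂ D-E~D')))
  legal-D : ∀ x → member x ≡ true → outdeg adj member x ≤ℤ D x
  legal-D x x∈S = ℤ.≤-trans (legal x x∈S) (ℤ.i≤j⇒i-k≤j (E x) {{nonNegative (single-nonneg q (suc k) x)}} ℤ.≤-refl)
  q∉S : member q ≡ false
  q∉S with member q in q∈S
  ... | false = refl
  ... | true = ⊥-elim (ℤ.<⇒≱ (subst (_<ℤ + 0) (sym Dq-Eq) -<+)
                              (ℤ.≤-trans (outdeg-nonneg adj member q) (legal q q∈S)))
    where
    Dq-Eq : D q - E q ≡ -[1+ k ]
    Dq-Eq rewrite Dq≡0 | single-self q (+ suc k) = refl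

laplacian-diag : ∀ {N} (adj : Adjacency N) q → laplacian adj q q ≡ degree adj q
laplacian-diag adj q rewrite ≡ᵇ-refl (toℕ q) = refl

laplacian-offdiag : ∀ {N} (adj : Adjacency N) x q → x ≢ q → laplacian adj x q ≡ - indicator (adj x q)
laplacian-offdiag adj x q x≢q rewrite ≢⇒≡ᵇ-false (toℕ x) (toℕ q) (x≢q ∘ Fin.toℕ-injective) with adj x q
... | true  = refl
... | false = refl

Equiv-refl : ∀ {N} (adj : Adjacency N) (D : Divisor N) → Equiv adj D D
Equiv-refl {N} adj D = (λ _ → + 0) , λ x → trans (ℤ.+-inverseʳ (D x))
  (sym (trans (sumFin-cong _ (λ _ → + 0) (λ w → ℤ.*-zeroʳ (laplacian adj x w))) (sumFin-zero {N})))

-- q borrows one chip from each of its neighbours.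
Equiv-borrow : ∀ {N} (adj : Adjacency N) D q → Equiv adj D (λ x → D x +ℤ laplacian adj x q)
Equiv-borrow adj D q = single q -[1+ 0 ] , λ x → begin
  D x - (D x +ℤ laplacian adj x q)                        ≡⟨ cancel (D x) (laplacian adj x q) ⟩
  - laplacian adj x q                                    ≡⟨ sumFin-δ q (λ w → - laplacian adj x w) ⟨
  sumFin (λ w → if toℕ q ≡ᵇ toℕ w then - laplacian adj x w else + 0)
                                                         ≡⟨ sumFin-cong _ _ (entry x) ⟨
  sumFin (λ w → laplacian adj x w * single q -[1+ 0 ] w) ∎
  where
  open ≡-Reasoning
  cancel : ∀ a b → a - (a +ℤ b) ≡ - b
  cancel = solve-∀
  entry : ∀ x w → laplacian adj x w * single q -[1+ 0 ] w ≡ (if toℕ q ≡ᵇ toℕ w then - laplacian adj x w else + 0)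
  entry x w with toℕ q ≡ᵇ toℕ w
  ... | true  = trans (ℤ.*-comm (laplacian adj x w) -[1+ 0 ]) (ℤ.-1*i≡-i _)
  ... | false = ℤ.*-zeroʳ (laplacian adj x w)

complement : ∀ {N} → (Fin N → Bool) → Divisor N
complement I x = indicator (not (I x))

module _ {N} (adj : Adjacency N) (I : Fin N → Bool)
         (independent : ∀ x y → adj x y ≡ true → I x ≡ true → I y ≡ true → ⊥)
         (no-isolated : ∀ x → + 1 ≤ℤ degree adj x) where

  complement-rank≥1 : RankProp adj (complement I) 1
  complement-rank≥1 E E≥0 degE≡1 with effective-degree1⇒unit E E≥0 degE≡1
  ... | q , Eq≡1 , Ex≡0 with I q in q∈I
  ...   | false = D-E , D-E≥0 , Equiv-refl adj D-E
    where
    D-E : Divisor N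
    D-E x = complement I x - E x
    D-E≥0 : Effective D-E
    D-E≥0 x with x Fin.≟ q
    ... | yes refl rewrite Eq≡1 | q∈I = +≤+ z≤n
    ... | no x≢q   rewrite Ex≡0 x x≢q = subst (+ 0 ≤ℤ_) (sym (ℤ.+-identityʳ _)) (indicator-nonneg (not (I x)))
  ...   | true = D' , D'≥0 , Equiv-borrow adj D-E q
    where
    D-E D' : Divisor N
    D-E x = complement I x - E x
    D' x = D-E x +ℤ laplacian adj x q
    D'≥0 : Effective D'
    D'≥0 x with x Fin.≟ q
    ... | yes refl rewrite Eq≡1 | q∈I | laplacian-diag adj x = ℤ.+-monoʳ-≤ -[1+ 0 ] (no-isolated x)
    ... | no x≢q   rewrite Ex≡0 x x≢q | laplacian-offdiag adj x q x≢q with adj x q in x~q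
    ...   | false = subst (+ 0 ≤ℤ_) (sym (trans (ℤ.+-identityʳ _) (ℤ.+-identityʳ _))) (indicator-nonneg (not (I x)))
    ...   | true with I x in x∈I
    ...     | true  = ⊥-elim (independent x q x~q x∈I q∈I)
    ...     | false = +≤+ z≤n

-- The complete slashed ladder

module Ladder (m-1 n-3 : ℕ) where

  -- Vertices are handled through their labels: u c and v c in the 0-based column c, w k for the
  -- extra vertices of K_n. KLadj m n x y reduces to edge (toℕ x) (toℕ y).

  m n : ℕ
  m = suc m-1
  n = 3 + n-3

  NV : ℕ
  NV = KLvert m n

  u v w : ℕ → ℕ
  u c = c
  v c = m + c
  w k = m + m + k

  edge : ℕ → ℕ → Bool
  edge a b = not (a ≡ᵇ b) ∧
    (ladderEdge (classify m a) (classify m b) ∨ ladderEdge (classify m b) (classify m a) ∨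
     (inClique m (classify m a) ∧ inClique m (classify m b)))

  edge-irrefl : ∀ a → edge a a ≡ false
  edge-irrefl a rewrite ≡ᵇ-refl a = refl

  edge-sym : ∀ a b → edge a b ≡ edge b a
  edge-sym a b rewrite ≡ᵇ-sym a b | Bool.∧-comm (inClique m (classify m a)) (inClique m (classify m b))
    with ladderEdge (classify m a) (classify m b) | ladderEdge (classify m b) (classify m a)
  ... | true  | true  = refl
  ... | true  | false = refl
  ... | false | true  = refl
  ... | false | false = refl

  edge-flip : ∀ a b → edge a b ≡ true → edge b a ≡ true
  edge-flip a b e = trans (edge-sym b a) e

  edge⇒≢ : ∀ a b → edge a b ≡ true → a ≢ b
  edge⇒≢ a .a e refl with trans (sym e) (edge-irrefl a)
  ... | ()

  KLirrefl : Irreflexive (KLadj m n)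
  KLirrefl x = edge-irrefl (toℕ x)

  classify-u : ∀ c → c < m → classify m (u c) ≡ U c
  classify-u c c<m rewrite <ᵇ-true c m c<m = refl

  classify-v : ∀ c → c < m → classify m (v c) ≡ V c
  classify-v c c<m rewrite <ᵇ-false (m + c) m (ℕ.m≤m+n m c) | <ᵇ-true (m + c) (m + m) (ℕ.+-monoʳ-< m c<m)
                         | ℕ.m+n∸m≡n m c = refl

  classify-w : ∀ k → classify m (w k) ≡ K
  classify-w k rewrite <ᵇ-false (w k) m (ℕ.≤-trans (ℕ.m≤m+n m m) (ℕ.m≤m+n (m + m) k))
                     | <ᵇ-false (w k) (m + m) (ℕ.m≤m+n (m + m) k) = refl

  u≢v : ∀ {c d} → c < m → u c ≢ v d
  u≢v {c} {d} c<m c≡m+d = ℕ.<-irrefl c≡m+d (ℕ.<-≤-trans c<m (ℕ.m≤m+n m d))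

  u≢u-suc : ∀ c → u c ≢ u (suc c)
  u≢u-suc c = ℕ.<⇒≢ (ℕ.n<1+n c)

  v≢v-suc : ∀ c → v c ≢ v (suc c)
  v≢v-suc c = u≢u-suc c ∘ ℕ.+-cancelˡ-≡ m _ _

  rung : ∀ c → c < m → edge (u c) (v c) ≡ true
  rung c c<m rewrite ≢⇒≡ᵇ-false (u c) (v c) (u≢v c<m) | classify-u c c<m | classify-v c c<m | ≡ᵇ-refl c = refl

  u-step : ∀ c → suc c < m → edge (u c) (u (suc c)) ≡ true
  u-step c c+1<m rewrite ≢⇒≡ᵇ-false (u c) (u (suc c)) (u≢u-suc c) | classify-u c (ℕ.<⇒≤ c+1<m)
                       | classify-u (suc c) c+1<m | ≡ᵇ-refl c = refl

  v-step : ∀ c → suc c < m → edge (v c) (v (suc c)) ≡ true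
  v-step c c+1<m rewrite ≢⇒≡ᵇ-false (v c) (v (suc c)) (v≢v-suc c) | classify-v c (ℕ.<⇒≤ c+1<m)
                       | classify-v (suc c) c+1<m | ≡ᵇ-refl c = refl

  slash-even : ∀ c → suc c < m → evenᵇ c ≡ true → edge (u c) (v (suc c)) ≡ true
  slash-even c c+1<m even rewrite ≢⇒≡ᵇ-false (u c) (v (suc c)) (u≢v (ℕ.<⇒≤ c+1<m))
                                | classify-u c (ℕ.<⇒≤ c+1<m) | classify-v (suc c) c+1<m
                                | ≢⇒≡ᵇ-false (suc c) c (≢-sym (u≢u-suc c)) | ≡ᵇ-refl c | even = refl

  slash-odd : ∀ c → suc c < m → evenᵇ c ≡ false → edge (v c) (u (suc c)) ≡ true
  slash-odd c c+1<m odd rewrite ≢⇒≡ᵇ-false (v c) (u (suc c)) (≢-sym (u≢v c+1<m))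
                              | classify-v c (ℕ.<⇒≤ c+1<m) | classify-u (suc c) c+1<m
                              | ≡ᵇ-refl c | odd = refl

  u<w : ∀ {c} k → c < m → u c < w k
  u<w k c<m = ℕ.<-≤-trans c<m (ℕ.≤-trans (ℕ.m≤m+n m m) (ℕ.m≤m+n (m + m) k))

  v<w : ∀ {c} k → c < m → v c < w k
  v<w k c<m = ℕ.<-≤-trans (ℕ.+-monoʳ-< m c<m) (ℕ.m≤m+n (m + m) k)

  m-1<m : m-1 < m
  m-1<m = ℕ.n<1+n m-1

  clique : ℕ → ℕ
  clique 0 = u m-1
  clique 1 = v m-1
  clique (suc (suc k)) = w k

  clique-member : ∀ i → inClique m (classify m (clique i)) ≡ true
  clique-member 0 rewrite classify-u m-1 m-1<m = ≡ᵇ-refl m-1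
  clique-member 1 rewrite classify-v m-1 m-1<m = ≡ᵇ-refl m-1
  clique-member (suc (suc k)) rewrite classify-w k = refl

  clique-injective : ∀ i j → clique i ≡ clique j → i ≡ j
  clique-injective 0             0             _ = refl
  clique-injective 1             1             _ = refl
  clique-injective 0             1             e = ⊥-elim (u≢v m-1<m e)
  clique-injective 1             0             e = ⊥-elim (u≢v m-1<m (sym e))
  clique-injective 0             (suc (suc k)) e = ⊥-elim (ℕ.<⇒≢ (u<w k m-1<m) e)
  clique-injective (suc (suc k)) 0             e = ⊥-elim (ℕ.<⇒≢ (u<w k m-1<m) (sym e))
  clique-injective 1             (suc (suc k)) e = ⊥-elim (ℕ.<⇒≢ (v<w k m-1<m) e)
  clique-injective (suc (suc k)) 1             e = ⊥-elim (ℕ.<⇒≢ (v<w k m-1<m) (sym e))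
  clique-injective (suc (suc j)) (suc (suc k)) e = cong (suc ∘ suc) (ℕ.+-cancelˡ-≡ (m + m) j k e)

  clique-edge : ∀ i j → i ≢ j → edge (clique i) (clique j) ≡ true
  clique-edge i j i≢j
    rewrite ≢⇒≡ᵇ-false (clique i) (clique j) (i≢j ∘ clique-injective i j) | clique-member i | clique-member j
          | Bool.∨-zeroʳ (ladderEdge (classify m (clique j)) (classify m (clique i)))
          | Bool.∨-zeroʳ (ladderEdge (classify m (clique i)) (classify m (clique j))) = refl

  u<NV : ∀ {c} → c < m → u c < NV
  u<NV c<m = ℕ.<-≤-trans c<m (ℕ.≤-trans (ℕ.m≤m+n m m) (ℕ.m≤m+n (m + m) (n ∸ 2)))

  v<NV : ∀ {c} → c < m → v c < NV
  v<NV c<m = ℕ.<-≤-trans (ℕ.+-monoʳ-< m c<m) (ℕ.m≤m+n (m + m) (n ∸ 2))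

  clique<NV : ∀ {i} → i < n → clique i < NV
  clique<NV {0}           _   = u<NV m-1<m
  clique<NV {1}           _   = v<NV m-1<m
  clique<NV {suc (suc k)} (s≤s (s≤s k<n-2)) = ℕ.+-monoʳ-< (m + m) k<n-2

  data Label : ℕ → Set where
    u-label : ∀ c → c < m → Label (u c)
    v-label : ∀ c → c < m → Label (v c)
    w-label : ∀ k → Label (w k)

  label : ∀ a → Label a
  label a with a ℕ.<? m
  ... | yes a<m = u-label a a<m
  ... | no  a≮m with a ℕ.<? m + m
  ...   | yes a<2m = subst Label m+[a∸m]≡a (v-label (a ∸ m) a∸m<m)
    where
    m+[a∸m]≡a = ℕ.m+[n∸m]≡n (ℕ.≮⇒≥ a≮m)
    a∸m<m = ℕ.+-cancelˡ-< m _ _ (subst (_< m + m) (sym m+[a∸m]≡a) a<2m)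
  ...   | no  a≮2m = subst Label (ℕ.m+[n∸m]≡n (ℕ.≮⇒≥ a≮2m)) (w-label (a ∸ (m + m)))

  neighbour : ∀ a → Σ ℕ λ b → b < NV × edge a b ≡ true
  neighbour a with label a
  ... | u-label c c<m = v c , v<NV c<m , rung c c<m
  ... | v-label c c<m = u c , u<NV c<m , edge-flip (u c) (v c) (rung c c<m)
  ... | w-label k     = u m-1 , u<NV m-1<m , clique-edge (2 + k) 0 (λ ())

  column : (ℕ → ℤ) → ℕ → ℤ
  column h c = h (u c) +ℤ h (v c)

  sumUpTo-vertices : ∀ h → sumUpTo NV h ≡ sumUpTo m-1 (column h) +ℤ sumUpTo n (h ∘ clique)
  sumUpTo-vertices h = begin
    sumUpTo NV h
      ≡⟨ sumUpTo-+ (m + m) (n ∸ 2) h ⟩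
    sumUpTo (m + m) h +ℤ sumUpTo (n ∸ 2) (h ∘ w)
      ≡⟨ cong (_+ℤ sumUpTo (n ∸ 2) (h ∘ w)) (trans (sumUpTo-+ m m h) (sym (sumUpTo-distrib m (h ∘ u) (h ∘ v)))) ⟩
    (sumUpTo m-1 (column h) +ℤ column h m-1) +ℤ sumUpTo (n ∸ 2) (h ∘ w)
      ≡⟨ reassociate (sumUpTo m-1 (column h)) (h (u m-1)) (h (v m-1)) (sumUpTo (n ∸ 2) (h ∘ w)) ⟩
    sumUpTo m-1 (column h) +ℤ (h (clique 0) +ℤ (h (clique 1) +ℤ sumUpTo (n ∸ 2) (h ∘ w)))
      ≡⟨ cong (λ t → sumUpTo m-1 (column h) +ℤ t) (sym cliqueSum) ⟩
    sumUpTo m-1 (column h) +ℤ sumUpTo n (h ∘ clique) ∎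
    where
    open ≡-Reasoning
    reassociate : ∀ s a b t → (s +ℤ (a +ℤ b)) +ℤ t ≡ s +ℤ (a +ℤ (b +ℤ t))
    reassociate = solve-∀
    cliqueSum : sumUpTo n (h ∘ clique) ≡ h (clique 0) +ℤ (h (clique 1) +ℤ sumUpTo (n ∸ 2) (h ∘ w))
    cliqueSum = begin
      sumUpTo n (h ∘ clique)                             ≡⟨ sumUpTo-cons (suc (n ∸ 2)) (h ∘ clique) ⟩
      h (clique 0) +ℤ sumUpTo (suc (n ∸ 2)) (h ∘ clique ∘ suc)
                                                         ≡⟨ cong (_+ℤ_ (h (clique 0))) (sumUpTo-cons (n ∸ 2) (h ∘ clique ∘ suc)) ⟩
      h (clique 0) +ℤ (h (clique 1) +ℤ sumUpTo (n ∸ 2) (h ∘ w)) ∎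

  ladderI : Cls → Bool
  ladderI (U c) = not (evenᵇ c) ∧ (suc c ℕ.<ᵇ m)
  ladderI (V c) = evenᵇ c ∧ (suc c ℕ.<ᵇ m)
  ladderI K     = false

  I : ℕ → Bool
  I a = ladderI (classify m a) ∨ (a ≡ᵇ w n-3)

  ladderI⇒¬inClique : ∀ c → ladderI c ≡ true → inClique m c ≡ false
  ladderI⇒¬inClique (U i) h = ≢⇒≡ᵇ-false i m-1 (ℕ.<⇒≢ (ℕ.≤-pred (<ᵇ⇒< _ _ (Bool.∧-conicalʳ _ _ h))))
  ladderI⇒¬inClique (V i) h = ≢⇒≡ᵇ-false i m-1 (ℕ.<⇒≢ (ℕ.≤-pred (<ᵇ⇒< _ _ (Bool.∧-conicalʳ _ _ h))))

  ladderI-no-ladderEdge : ∀ c d → ladderI c ≡ true → ladderI d ≡ true → ladderEdge c d ≡ true → ⊥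
  ladderI-no-ladderEdge (U i) (U j) hc hd e with ≡ᵇ⇒≡ j (suc i) e
  ... | refl = not-both-true (not (evenᵇ i)) (Bool.∧-conicalˡ _ _ hc) (Bool.∧-conicalˡ _ _ hd)
  ladderI-no-ladderEdge (V i) (V j) hc hd e with ≡ᵇ⇒≡ j (suc i) e
  ... | refl = not-both-true (evenᵇ i) (Bool.∧-conicalˡ _ _ hc) (Bool.∧-conicalˡ _ _ hd)
  ladderI-no-ladderEdge (U i) (V j) hc hd e with ∨≡true (j ≡ᵇ i) _ e
  ... | inj₁ j≡ᵇi with ≡ᵇ⇒≡ j i j≡ᵇi
  ...   | refl = not-both-true (evenᵇ i) (Bool.∧-conicalˡ _ _ hd) (Bool.∧-conicalˡ _ _ hc)
  ladderI-no-ladderEdge (U i) (V j) hc hd e | inj₂ slash =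
    not-both-true (evenᵇ i) (Bool.∧-conicalʳ _ _ slash) (Bool.∧-conicalˡ _ _ hc)
  ladderI-no-ladderEdge (V i) (U j) hc hd e = not-both-true (evenᵇ i) (Bool.∧-conicalˡ _ _ hc) (Bool.∧-conicalʳ _ _ e)
  ladderI-no-ladderEdge (U i) K hc ()
  ladderI-no-ladderEdge (V i) K hc ()
  ladderI-no-ladderEdge K d ()

  ladderEdge-K : ∀ c → ladderEdge c K ≡ false
  ladderEdge-K (U _) = refl
  ladderEdge-K (V _) = refl
  ladderEdge-K K     = refl

  ladderI-independent : ∀ a b → edge a b ≡ true → ladderI (classify m a) ≡ true → ladderI (classify m b) ≡ true → ⊥
  ladderI-independent a b e ha hb
    with ∨≡true (ladderEdge ca cb) _ (subst (λ t → (ladderEdge ca cb ∨ ladderEdge cb ca ∨ t ∧ inClique m cb) ≡ true)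
                                            (ladderI⇒¬inClique ca ha) (Bool.∧-conicalʳ _ _ e))
    where
    ca = classify m a
    cb = classify m b
  ... | inj₁ e-ab = ladderI-no-ladderEdge (classify m a) (classify m b) ha hb e-ab
  ... | inj₂ e-ba with ∨≡true (ladderEdge (classify m b) (classify m a)) false e-ba
  ...   | inj₁ e-ba' = ladderI-no-ladderEdge (classify m b) (classify m a) hb ha e-ba'
  ...   | inj₂ ()

  K-ladderI-nonadjacent : ∀ c → ladderI c ≡ true →
                          (ladderEdge K c ∨ ladderEdge c K ∨ (inClique m K ∧ inClique m c)) ≡ false
  K-ladderI-nonadjacent c hc rewrite ladderEdge-K c | ladderI⇒¬inClique c hc with c
  ... | U _ = refl
  ... | V _ = refl
  ... | K   = refl

  no-ladderI-neighbour-of-last : ∀ b → edge (w n-3) b ≡ true → ladderI (classify m b) ≡ true → ⊥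
  no-ladderI-neighbour-of-last b e hb with
    trans (sym (subst (λ c → (ladderEdge c cb ∨ ladderEdge cb c ∨ (inClique m c ∧ inClique m cb)) ≡ true)
                      (classify-w n-3) (Bool.∧-conicalʳ _ _ e)))
          (K-ladderI-nonadjacent cb hb)
    where cb = classify m b
  ... | ()

  I-independent : ∀ a b → edge a b ≡ true → I a ≡ true → I b ≡ true → ⊥
  I-independent a b e ha hb with ∨≡true (ladderI (classify m a)) _ ha | ∨≡true (ladderI (classify m b)) _ hb
  ... | inj₁ la | inj₁ lb = ladderI-independent a b e la lb
  ... | inj₂ a≡last | inj₁ lb rewrite ≡ᵇ⇒≡ a (w n-3) a≡last = no-ladderI-neighbour-of-last b e lb
  ... | inj₁ la | inj₂ b≡last rewrite ≡ᵇ⇒≡ b (w n-3) b≡last =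
    no-ladderI-neighbour-of-last a (edge-flip a (w n-3) e) la
  ... | inj₂ a≡last | inj₂ b≡last = edge⇒≢ a b e (trans (≡ᵇ⇒≡ a _ a≡last) (sym (≡ᵇ⇒≡ b _ b≡last)))

  D₀ : ℕ → ℤ
  D₀ a = indicator (not (I a))

  D₀-column : ∀ c → suc c < m → column D₀ c ≡ + 1
  D₀-column c c+1<m
    rewrite classify-u c (ℕ.<⇒≤ c+1<m) | classify-v c (ℕ.<⇒≤ c+1<m) | <ᵇ-true (suc c) m c+1<m
          | ≢⇒≡ᵇ-false (u c) (w n-3) (ℕ.<⇒≢ (u<w n-3 (ℕ.<⇒≤ c+1<m)))
          | ≢⇒≡ᵇ-false (v c) (w n-3) (ℕ.<⇒≢ (v<w n-3 (ℕ.<⇒≤ c+1<m)))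
    with evenᵇ c
  ... | true  = refl
  ... | false = refl

  D₀-clique : ∀ i → i < 2 + n-3 → D₀ (clique i) ≡ + 1
  D₀-clique 0 _ rewrite classify-u m-1 m-1<m | <ᵇ-false (suc m-1) m ℕ.≤-refl | Bool.∧-zeroʳ (not (evenᵇ m-1))
                      | ≢⇒≡ᵇ-false (u m-1) (w n-3) (ℕ.<⇒≢ (u<w n-3 m-1<m)) = refl
  D₀-clique 1 _ rewrite classify-v m-1 m-1<m | <ᵇ-false (suc m-1) m ℕ.≤-refl | Bool.∧-zeroʳ (evenᵇ m-1)
                      | ≢⇒≡ᵇ-false (v m-1) (w n-3) (ℕ.<⇒≢ (v<w n-3 m-1<m)) = refl
  D₀-clique (suc (suc k)) (s≤s (s≤s k<n-3))
    rewrite classify-w k | ≢⇒≡ᵇ-false (w k) (w n-3) (ℕ.<⇒≢ k<n-3 ∘ ℕ.+-cancelˡ-≡ (m + m) k n-3) = refl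

  D₀-last : D₀ (w n-3) ≡ + 0
  D₀-last rewrite classify-w n-3 | ≡ᵇ-refl (w n-3) = refl

  sumUpTo-D₀ : sumUpTo NV D₀ ≡ + (n + m ∸ 2)
  sumUpTo-D₀ = begin
    sumUpTo NV D₀
      ≡⟨ sumUpTo-vertices D₀ ⟩
    sumUpTo m-1 (column D₀) +ℤ (sumUpTo (2 + n-3) (D₀ ∘ clique) +ℤ D₀ (w n-3))
      ≡⟨ cong₂ (λ s t → s +ℤ (t +ℤ D₀ (w n-3)))
               (sumUpTo-ones m-1 (column D₀) (λ c c<m-1 → D₀-column c (s≤s c<m-1)))
               (sumUpTo-ones (2 + n-3) (D₀ ∘ clique) D₀-clique) ⟩
    + m-1 +ℤ (+ (2 + n-3) +ℤ D₀ (w n-3))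
      ≡⟨ cong (λ t → + m-1 +ℤ (+ (2 + n-3) +ℤ t)) D₀-last ⟩
    + (m-1 + (2 + n-3 + 0))
      ≡⟨ cong +_ (arith m-1 n-3) ⟩
    + (n + m ∸ 2) ∎
    where
    open ≡-Reasoning
    arith : ∀ a b → a + (2 + b + 0) ≡ suc (b + suc a)
    arith = ℕ-Solver.solve-∀

  upperBound : Σ (Divisor NV) λ D → Effective D × MultFree D × PositiveRank (KLadj m n) D × divDeg D ≡ + (n + m ∸ 2)
  upperBound = complement Iᶠ , (λ x → indicator-nonneg _) , (λ x → indicator-≤1 _) ,
               (1 , ℕ.≤-refl , complement-rank≥1 (KLadj m n) Iᶠ (λ x y → I-independent (toℕ x) (toℕ y)) no-isolated) ,
               trans (sumFin≡sumUpTo (complement Iᶠ) D₀ (λ _ → refl)) sumUpTo-D₀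
    where
    Iᶠ : Fin NV → Bool
    Iᶠ x = I (toℕ x)
    no-isolated : ∀ x → + 1 ≤ℤ degree (KLadj m n) x
    no-isolated x with neighbour (toℕ x)
    ... | b , b<NV , x~b = degree-≥1 (KLadj m n) x (Fin.fromℕ< b<NV)
                             (subst (λ t → edge (toℕ x) t ≡ true) (sym (Fin.toℕ-fromℕ< b<NV)) x~b)

  module LowerBound (D : Divisor NV) (D≥0 : Effective D) (D≤1 : MultFree D) (rank : PositiveRank (KLadj m n) D) where

    d : ℕ → ℤ
    d = extend (+ 0) D

    d≥0 : ∀ a → + 0 ≤ℤ d a
    d≥0 a with a ℕ.<? NV
    ... | yes a<NV = D≥0 (Fin.fromℕ< a<NV)
    ... | no  _    = +≤+ z≤n

    d≤1 : ∀ a → d a ≤ℤ + 1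
    d≤1 a with a ℕ.<? NV
    ... | yes a<NV = D≤1 (Fin.fromℕ< a<NV)
    ... | no  _    = +≤+ z≤n

    module Firing (S : FiringSet (KLadj m n) D) where

      open FiringSet S

      inA : ℕ → Bool
      inA = extend false member

      inA⇒<NV : ∀ {a} → inA a ≡ true → a < NV
      inA⇒<NV {a} a∈A =
        decidable-stable (a ℕ.<? NV) λ a≮NV → false≢true (trans (sym (extend-outside false member a≮NV)) a∈A)

      private
        vertex : ∀ {a} → a < NV → Fin NV
        vertex a<NV = Fin.fromℕ< a<NV

        edge-at : ∀ {a b} (a<NV : a < NV) (b<NV : b < NV) → edge a b ≡ true → KLadj m n (vertex a<NV) (vertex b<NV) ≡ true
        edge-at a<NV b<NV = subst₂ (λ s t → edge s t ≡ true) (sym (Fin.toℕ-fromℕ< a<NV)) (sym (Fin.toℕ-fromℕ< b<NV))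

        outdeg≤d : ∀ {a} (a∈A : inA a ≡ true) → outdeg (KLadj m n) member (vertex (inA⇒<NV {a} a∈A)) ≤ℤ d a
        outdeg≤d {a} a∈A = subst (outdeg (KLadj m n) member (vertex a<NV) ≤ℤ_) (sym (extend-fromℕ< (+ 0) D {a} a<NV))
                                 (legal (vertex a<NV) (trans (sym (extend-fromℕ< false member {a} a<NV)) a∈A))
          where a<NV = inA⇒<NV {a} a∈A

        outside-at : ∀ {b} (b<NV : b < NV) → inA b ≡ false → member (vertex b<NV) ≡ false
        outside-at {b} b<NV b∉A = trans (sym (extend-fromℕ< false member {b} b<NV)) b∉A

      neighbour-outside⇒d≡1 : ∀ {a b} → b < NV → inA a ≡ true → inA b ≡ false → edge a b ≡ true → d a ≡ + 1
      neighbour-outside⇒d≡1 {a} b<NV a∈A b∉A a~b = ℤ.≤-antisym (d≤1 a)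
        (ℤ.≤-trans (outdeg-≥1 (KLadj m n) member (vertex a<NV) (vertex b<NV) (edge-at a<NV b<NV a~b) (outside-at b<NV b∉A))
                   (outdeg≤d {a} a∈A))
        where a<NV = inA⇒<NV {a} a∈A

      two-neighbours-outside : ∀ {a b₁ b₂} → b₁ < NV → b₂ < NV → b₁ ≢ b₂ → inA a ≡ true →
                               inA b₁ ≡ false → inA b₂ ≡ false → edge a b₁ ≡ true → edge a b₂ ≡ true → ⊥
      two-neighbours-outside {a} b₁<NV b₂<NV b₁≢b₂ a∈A b₁∉A b₂∉A a~b₁ a~b₂ = 2≰1
        (ℤ.≤-trans (outdeg-≥2 (KLadj m n) member (vertex a<NV) (vertex b₁<NV) (vertex b₂<NV) vertices-distinct
                      (edge-at a<NV b₁<NV a~b₁) (outside-at b₁<NV b₁∉A) (edge-at a<NV b₂<NV a~b₂) (outside-at b₂<NV b₂∉A))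
          (ℤ.≤-trans (outdeg≤d {a} a∈A) (d≤1 a)))
        where
        a<NV = inA⇒<NV {a} a∈A
        vertices-distinct : vertex b₁<NV ≢ vertex b₂<NV
        vertices-distinct e = b₁≢b₂ (trans (sym (Fin.toℕ-fromℕ< b₁<NV)) (trans (cong toℕ e) (Fin.toℕ-fromℕ< b₂<NV)))
        2≰1 : ¬ (+ 2 ≤ℤ + 1)
        2≰1 (+≤+ (s≤s ()))

      -- If A missed y and ȳ, whichever of x, x̄ lies in A would have two neighbours outside A.
      spread : ∀ x x̄ y ȳ → x < NV → y < NV → ȳ < NV → y ≢ ȳ →
               edge x x̄ ≡ true → edge x y ≡ true → edge x ȳ ≡ true → edge x̄ y ≡ true →
               inA x ≡ true ⊎ inA x̄ ≡ true → inA y ≡ true ⊎ inA ȳ ≡ true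
      spread x x̄ y ȳ x<NV y<NV ȳ<NV y≢ȳ x~x̄ x~y x~ȳ x̄~y x-or-x̄ with inA y in y∈A | inA ȳ in ȳ∈A
      ... | true  | _     = inj₁ refl
      ... | false | true  = inj₂ refl
      ... | false | false with x-or-x̄
      ...   | inj₁ x∈A = ⊥-elim (two-neighbours-outside {x} y<NV ȳ<NV y≢ȳ x∈A y∈A ȳ∈A x~y x~ȳ)
      ...   | inj₂ x̄∈A with inA x in x∈A
      ...     | true  = ⊥-elim (two-neighbours-outside {x} y<NV ȳ<NV y≢ȳ x∈A y∈A ȳ∈A x~y x~ȳ)
      ...     | false =
        ⊥-elim (two-neighbours-outside {x̄} x<NV y<NV (edge⇒≢ x y x~y) x̄∈A x∈A y∈A (edge-flip x x̄ x~x̄) x̄~y)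

      Meets : ℕ → Set
      Meets c = inA (u c) ≡ true ⊎ inA (v c) ≡ true

      meets-suc : ∀ c → suc c < m → Meets c → Meets (suc c)
      meets-suc c c+1<m with evenᵇ c in parity
      ... | true  = Sum.swap ∘ spread (u c) (v c) (v (suc c)) (u (suc c))
                      (u<NV c<m) (v<NV c+1<m) (u<NV c+1<m) (≢-sym (u≢v c+1<m))
                      (rung c c<m) (slash-even c c+1<m parity) (u-step c c+1<m) (v-step c c+1<m)
        where c<m = ℕ.<⇒≤ c+1<m
      ... | false = spread (v c) (u c) (u (suc c)) (v (suc c))
                      (v<NV c<m) (u<NV c+1<m) (v<NV c+1<m) (u≢v c+1<m)
                      (edge-flip (u c) (v c) (rung c c<m)) (slash-odd c c+1<m parity) (v-step c c+1<m) (u-step c c+1<m)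
                    ∘ Sum.swap
        where c<m = ℕ.<⇒≤ c+1<m

      meets-pred : ∀ c → suc c < m → Meets (suc c) → Meets c
      meets-pred c c+1<m with evenᵇ c in parity
      ... | true  = spread (v (suc c)) (u (suc c)) (u c) (v c)
                      (v<NV c+1<m) (u<NV c<m) (v<NV c<m) (u≢v c<m)
                      (edge-flip (u (suc c)) (v (suc c)) (rung (suc c) c+1<m))
                      (edge-flip (u c) (v (suc c)) (slash-even c c+1<m parity))
                      (edge-flip (v c) (v (suc c)) (v-step c c+1<m))
                      (edge-flip (u c) (u (suc c)) (u-step c c+1<m))
                    ∘ Sum.swap
        where c<m = ℕ.<⇒≤ c+1<m
      ... | false = Sum.swap ∘ spread (u (suc c)) (v (suc c)) (v c) (u c)
                      (u<NV c+1<m) (v<NV c<m) (u<NV c<m) (≢-sym (u≢v c<m))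
                      (rung (suc c) c+1<m)
                      (edge-flip (v c) (u (suc c)) (slash-odd c c+1<m parity))
                      (edge-flip (u c) (u (suc c)) (u-step c c+1<m))
                      (edge-flip (v c) (v (suc c)) (v-step c c+1<m))
        where c<m = ℕ.<⇒≤ c+1<m

      meets-first : ∀ c → c < m → Meets c → Meets 0
      meets-first zero    _     = id
      meets-first (suc c) c+1<m = meets-first c (ℕ.<⇒≤ c+1<m) ∘ meets-pred c c+1<m

      meets-from-first : ∀ c → c < m → Meets 0 → Meets c
      meets-from-first zero    _     = id
      meets-from-first (suc c) c+1<m = meets-suc c c+1<m ∘ meets-from-first c (ℕ.<⇒≤ c+1<m)

      meets-every-column : ∀ {c c′} → c < m → c′ < m → Meets c → Meets c′
      meets-every-column {c} {c′} c<m c′<m = meets-from-first c′ c′<m ∘ meets-first c c<m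

      private
        meets-last-from : ∀ a → Label a → inA a ≡ true → Meets m-1
        meets-last-from _ (u-label c c<m) c∈A = meets-every-column c<m m-1<m (inj₁ c∈A)
        meets-last-from _ (v-label c c<m) c∈A = meets-every-column c<m m-1<m (inj₂ c∈A)
        meets-last-from _ (w-label k)     k∈A with inA (u m-1) in u∈A | inA (v m-1) in v∈A
        ... | true  | _     = inj₁ refl
        ... | false | true  = inj₂ refl
        ... | false | false = ⊥-elim (two-neighbours-outside {w k} (u<NV m-1<m) (v<NV m-1<m) (u≢v m-1<m) k∈A u∈A v∈A
                                        (clique-edge (2 + k) 0 (λ ())) (clique-edge (2 + k) 1 (λ ())))

      meets-last : Meets m-1
      meets-last = meets-last-from (toℕ x) (label (toℕ x)) (trans (extend-toℕ false member x) x∈A)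
        where
        x = proj₁ nonempty
        x∈A = proj₂ nonempty

      no-empty-column : ∀ c → c < m → inA (u c) ≡ false → d (v c) ≡ + 0 → ⊥
      no-empty-column c c<m u∉A dv≡0 with inA (v c) in v∈A | meets-every-column m-1<m c<m meets-last
      ... | true  | _          =
        1≢0 (trans (sym (neighbour-outside⇒d≡1 {v c} (u<NV c<m) v∈A u∉A (edge-flip (u c) (v c) (rung c c<m)))) dv≡0)
      ... | false | inj₁ u∈A   = false≢true (trans (sym u∉A) u∈A)
      ... | false | inj₂ v∈A   = false≢true v∈A

      no-clique-pair : ∀ i j → i ≢ j → i < n → j < n → inA (clique i) ≡ false → d (clique j) ≡ + 0 → ⊥
      no-clique-pair i j i≢j i<n j<n i∉A dj≡0 with inA (clique j) in j∈A
      ... | true  =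
        1≢0 (trans (sym (neighbour-outside⇒d≡1 {clique j} (clique<NV i<n) j∈A i∉A (clique-edge j i (i≢j ∘ sym)))) dj≡0)
      ... | false = Sum.[ clique-vertex-outside 0 , clique-vertex-outside 1 ] meets-last
        where
        clique-vertex-outside : ∀ k → inA (clique k) ≡ true → ⊥
        clique-vertex-outside k k∈A =
          two-neighbours-outside {clique k} (clique<NV i<n) (clique<NV j<n) (i≢j ∘ clique-injective i j) k∈A i∉A j∈A
            (clique-edge k i (λ { refl → false≢true (trans (sym i∉A) k∈A) }))
            (clique-edge k j (λ { refl → false≢true (trans (sym j∈A) k∈A) }))

    avoiding : ∀ {a} → a < NV → d a ≡ + 0 → Σ (FiringSet (KLadj m n) D) λ S → Firing.inA S a ≡ false
    avoiding {a} a<NV da≡0 with positiveRank⇒firingSet-avoiding (KLadj m n) KLirrefl D (Fin.fromℕ< a<NV)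
                                   (trans (sym (extend-fromℕ< (+ 0) D {a} a<NV)) da≡0) rank
    ... | S , q∉S = S , trans (extend-fromℕ< false (FiringSet.member S) {a} a<NV) q∉S

    divDeg-split : divDeg D ≡ sumUpTo m-1 (column d) +ℤ sumUpTo n (d ∘ clique)
    divDeg-split = trans (sumFin≡sumUpTo D d (λ x → sym (extend-toℕ (+ 0) D x))) (sumUpTo-vertices d)

    count⇒bound : ∀ {C S} → + m-1 ≤ℤ C → + n ≤ℤ S +ℤ + 1 → + (n + m ∸ 2) ≤ℤ C +ℤ S
    count⇒bound {C} {S} m-1≤C n≤S+1 =
      +-cancelʳ-≤ (+ 1) (subst₂ _≤ℤ_ (cong +_ (arith m-1 n-3)) (sym (ℤ.+-assoc C S (+ 1))) (ℤ.+-mono-≤ m-1≤C n≤S+1))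
      where
      arith : ∀ a b → a + (3 + b) ≡ suc (b + suc a) + 1
      arith = ℕ-Solver.solve-∀

    lowerBound : + (n + m ∸ 2) ≤ℤ divDeg D
    lowerBound with sumUpTo-zero-or-≥ m-1 (column d) (λ c → ℤ.+-mono-≤ (d≥0 (u c)) (d≥0 (v c)))
                  | zeroCount n (d ∘ clique) (d≥0 ∘ clique)
    ... | inj₁ (c , c<m-1 , column≡0) | _ with nonneg-+≡0 (d≥0 (u c)) (d≥0 (v c)) column≡0
    ...   | du≡0 , dv≡0 with avoiding (u<NV (ℕ.m<n⇒m<1+n c<m-1)) du≡0
    ...     | S , u∉A = ⊥-elim (Firing.no-empty-column S c (ℕ.m<n⇒m<1+n c<m-1) u∉A dv≡0)
    lowerBound | inj₂ _ | two-zeros i j i<j j<n di≡0 dj≡0 with avoiding (clique<NV (ℕ.<-trans i<j j<n)) di≡0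
    ... | S , i∉A = ⊥-elim (Firing.no-clique-pair S i j (ℕ.<⇒≢ i<j) (ℕ.<-trans i<j j<n) j<n i∉A dj≡0)
    lowerBound | inj₂ m-1≤C | one-zero _ _ _ n≤S+1 = subst (_ ≤ℤ_) (sym divDeg-split) (count⇒bound m-1≤C n≤S+1)
    lowerBound | inj₂ m-1≤C | no-zero n≤S =
      subst (_ ≤ℤ_) (sym divDeg-split) (count⇒bound m-1≤C (ℤ.≤-trans n≤S (ℤ.i≤i+j _ (+ 1))))

lemma4p4 : (m n : ℕ) → 2 ≤ m → 3 ≤ n → MfgonIs (KLadj m n) ((n + m) ∸ 2)
lemma4p4 (suc m-1) (suc (suc (suc n-3))) _ _ = upperBound , LowerBound.lowerBound
  where open Ladder m-1 n-3
lemma4p4 (suc _) 1 _ (s≤s ())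
lemma4p4 (suc _) 2 _ (s≤s (s≤s ()))
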